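{- For every integer $n>0$, the number $99\times R_n$ is a Ball magic number, where $R_n=\frac{10^n-1}{9}$ is the number written with $n$ ones.
   Context: Ball magic number: let $N\ge 2$ and let $x$ be a positive integer with exactly $N$ decimal digits, $x=a_{N-1}\dots a_0$ with $a_{N-1}\neq 0$, which is not a palindrome. Its reverse $x'$ is the integer with digit string $a_0a_1\dots a_{N-1}$ (leading zeros allowed). Let $y=|x-x'|$, written as an $N$-digit string $b_{N-1}\dots b_0$ (leading zeros allowed), and let $y'$ be the integer with digit string $b_0\dots b_{N-1}$. The nonzero integer $B=y+y'$ is a Ball magic number; a Ball magic number is any integer obtained this way from some such $x$. -}

module Defs where

open import Data.Nat using (ℕ; zero; suc; _+_; _*_; _∸_; _^_; _≤_; ∣_-_∣; _/_; _%_)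
open import Data.Fin using (Fin; toℕ) renaming (zero to fzero)
open import Data.Vec using (Vec; []; _∷_; _∷ʳ_; reverse; foldl; head)
open import Data.Nat.DivMod using (m%n<n)
open import Data.Fin using (fromℕ<)
open import Data.Product using (Σ; ∃; _×_; _,_)
open import Relation.Binary.PropositionalEquality using (_≡_; _≢_)

-- A digit string in base 10, most significant digit first.
Digits : ℕ → Set
Digits N = Vec (Fin 10) N

value : ∀ {N} → Digits N → ℕ
value = foldl (λ _ → ℕ) (λ acc d → 10 * acc + toℕ d) 0

-- The N-digit string (most significant first, leading zeros allowed)
-- of y mod 10^N, i.e. of y whenever y < 10^N.
toDigits : (N : ℕ) → ℕ → Digits N
toDigits zero    y = []
toDigits (suc N) y = toDigits N (y / 10) ∷ʳ fromℕ< (m%n<n y 10)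

revN : (N : ℕ) → ℕ → ℕ
revN N y = value (reverse (toDigits N y))

-- The Ball number obtained from an N-digit string x:
-- y = |x - x'|, B = y + y' (y written with N digits).
ballOf : ∀ {N} → Digits N → ℕ
ballOf {N} x = y + revN N y
  where
    y : ℕ
    y = ∣ value x - value (reverse x) ∣

-- B is a Ball magic number: obtained from some x with exactly N ≥ 2 digits
-- (leading digit nonzero) that is not a palindrome, and B is nonzero.
BallMagic : ℕ → Set
BallMagic B =
  Σ ℕ λ N → 2 ≤ N × Σ (Digits N) λ x →
    (head′ x ≢ fzero) × (reverse x ≢ x) × (ballOf x ≡ B) × (B ≢ 0)
  where
    head′ : ∀ {N} → Digits N → Fin 10
    head′ [] = fzero
    head′ (d ∷ _) = d

repunit : ℕ → ℕ
repunit n = (10 ^ n ∸ 1) / 9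

-- Take x = 10ⁿ, written 1 0 … 0 with n + 1 digits, whose reverse is 1.
-- Then y = 10ⁿ − 1 has the (n + 1)-digit string 0 9 … 9, whose reverse
-- 9 … 9 0 is 10 y, so B = 11 y = 11 · 9 · Rₙ = 99 Rₙ.
module Submission where

open import Defs
open import Data.Nat using (ℕ; zero; suc; _+_; _*_; _∸_; _^_; _/_; _%_; _<_; _>_; ∣_-_∣; s≤s; z≤n)
open import Data.Nat.Properties using (m≤n⇒∣n-m∣≡n∸m; *-comm; *-identityˡ; +-identityʳ; m+n≡0⇒m≡0; m*n≡0⇒m≡0∨n≡0; m^n≡0⇒m≡0)
open import Data.Nat.DivMod using (m*n/n≡m; +-distrib-/-∣ˡ; %-remove-+ˡ; m<n⇒m/n≡0; m<n⇒m%n≡m)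
open import Data.Nat.Divisibility using (m∣m*n)
open import Data.Nat.Tactic.RingSolver using (solve-∀)
open import Data.Fin using (toℕ; #_)
open import Data.Fin.Properties using (toℕ-injective; toℕ-fromℕ<; toℕ<n)
open import Data.Vec using ([]; _∷_; _∷ʳ_; reverse; foldl; replicate; initLast)
open import Data.Vec.Properties using (reverse-∷; foldl-∷ʳ)
open import Data.Product using (_,_)
open import Data.Sum using (inj₂)
open import Relation.Binary.PropositionalEquality

valueFrom : ∀ {N} → ℕ → Digits N → ℕ
valueFrom = foldl (λ _ → ℕ) (λ acc d → 10 * acc + toℕ d)

valueFrom≡a*10^N+value : ∀ {N} a (xs : Digits N) → valueFrom a xs ≡ a * 10 ^ N + value xs
valueFrom≡a*10^N+value a [] = a≡a*1+0 a
  where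
  a≡a*1+0 : ∀ a → a ≡ a * 1 + 0
  a≡a*1+0 = solve-∀
valueFrom≡a*10^N+value {suc N} a (d ∷ xs) = begin
  valueFrom (10 * a + toℕ d) xs               ≡⟨ valueFrom≡a*10^N+value (10 * a + toℕ d) xs ⟩
  (10 * a + toℕ d) * 10 ^ N + value xs        ≡⟨ regroup a (toℕ d) (10 ^ N) (value xs) ⟩
  a * (10 * 10 ^ N) + (toℕ d * 10 ^ N + value xs) ≡⟨ cong (a * 10 ^ suc N +_) (valueFrom≡a*10^N+value (toℕ d) xs) ⟨
  a * 10 ^ suc N + valueFrom (toℕ d) xs       ∎
  where
  open ≡-Reasoning
  regroup : ∀ a d p v → (10 * a + d) * p + v ≡ a * (10 * p) + (d * p + v)
  regroup = solve-∀

value-∷ : ∀ {N} d (xs : Digits N) → value (d ∷ xs) ≡ toℕ d * 10 ^ N + value xs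
value-∷ d = valueFrom≡a*10^N+value (toℕ d)

value-∷ʳ : ∀ {N} (xs : Digits N) d → value (xs ∷ʳ d) ≡ 10 * value xs + toℕ d
value-∷ʳ xs d = foldl-∷ʳ (λ _ → ℕ) (λ acc d → 10 * acc + toℕ d) 0 d xs

[10*q+r]/10≡q : ∀ q {r} → r < 10 → (10 * q + r) / 10 ≡ q
[10*q+r]/10≡q q {r} r<10 = begin
  (10 * q + r) / 10     ≡⟨ +-distrib-/-∣ˡ r (m∣m*n q) ⟩
  10 * q / 10 + r / 10  ≡⟨ cong₂ _+_ (trans (cong (_/ 10) (*-comm 10 q)) (m*n/n≡m q 10)) (m<n⇒m/n≡0 r<10) ⟩
  q + 0                 ≡⟨ +-identityʳ q ⟩
  q                     ∎
  where open ≡-Reasoning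

[10*q+r]%10≡r : ∀ q {r} → r < 10 → (10 * q + r) % 10 ≡ r
[10*q+r]%10≡r q {r} r<10 = trans (%-remove-+ˡ r (m∣m*n q)) (m<n⇒m%n≡m r<10)

toDigits-value : ∀ {N} (xs : Digits N) → toDigits N (value xs) ≡ xs
toDigits-value {zero} [] = refl
toDigits-value {suc N} xs with initLast xs
... | ys , d , refl rewrite value-∷ʳ ys d =
  cong₂ _∷ʳ_ (trans (cong (toDigits N) ([10*q+r]/10≡q (value ys) (toℕ<n d))) (toDigits-value ys))
             (toℕ-injective (trans (toℕ-fromℕ< _) ([10*q+r]%10≡r (value ys) (toℕ<n d))))

revN-value : ∀ {N} (xs : Digits N) → revN N (value xs) ≡ value (reverse xs)
revN-value xs = cong (λ ys → value (reverse ys)) (toDigits-value xs)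

reverse-replicate : ∀ {A : Set} n (a : A) → reverse (replicate n a) ≡ replicate n a
reverse-replicate zero    a = refl
reverse-replicate (suc n) a = begin
  reverse (a ∷ replicate n a)     ≡⟨ reverse-∷ a (replicate n a) ⟩
  reverse (replicate n a) ∷ʳ a    ≡⟨ cong (_∷ʳ a) (reverse-replicate n a) ⟩
  replicate n a ∷ʳ a              ≡⟨ replicate-∷ʳ n ⟩
  a ∷ replicate n a               ∎
  where
  open ≡-Reasoning
  replicate-∷ʳ : ∀ n → replicate n a ∷ʳ a ≡ a ∷ replicate n a
  replicate-∷ʳ zero    = refl
  replicate-∷ʳ (suc n) = cong (a ∷_) (replicate-∷ʳ n)

value-zeros : ∀ n → value (replicate n (# 0)) ≡ 0
value-zeros zero    = refl
value-zeros (suc n) = trans (value-∷ (# 0) (replicate n (# 0))) (value-zeros n)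

1+value-nines : ∀ n → 1 + value (replicate n (# 9)) ≡ 10 ^ n
1+value-nines zero    = refl
1+value-nines (suc n) = begin
  1 + value (replicate (suc n) (# 9))                ≡⟨ cong suc (value-∷ (# 9) (replicate n (# 9))) ⟩
  1 + (9 * 10 ^ n + value (replicate n (# 9)))       ≡⟨ shuffle (10 ^ n) (value (replicate n (# 9))) ⟩
  9 * 10 ^ n + (1 + value (replicate n (# 9)))       ≡⟨ cong (9 * 10 ^ n +_) (1+value-nines n) ⟩
  9 * 10 ^ n + 10 ^ n                                ≡⟨ nine+one (10 ^ n) ⟩
  10 * 10 ^ n                                        ∎
  where
  open ≡-Reasoning
  shuffle : ∀ p v → 1 + (9 * p + v) ≡ 9 * p + (1 + v)
  shuffle = solve-∀
  nine+one : ∀ p → 9 * p + p ≡ 10 * p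
  nine+one = solve-∀

value-nines≡9*value-ones : ∀ n → value (replicate n (# 9)) ≡ 9 * value (replicate n (# 1))
value-nines≡9*value-ones zero    = refl
value-nines≡9*value-ones (suc n) = begin
  value (replicate (suc n) (# 9))                  ≡⟨ value-∷ (# 9) (replicate n (# 9)) ⟩
  9 * 10 ^ n + value (replicate n (# 9))           ≡⟨ cong (9 * 10 ^ n +_) (value-nines≡9*value-ones n) ⟩
  9 * 10 ^ n + 9 * value (replicate n (# 1))       ≡⟨ distrib (10 ^ n) (value (replicate n (# 1))) ⟩
  9 * (1 * 10 ^ n + value (replicate n (# 1)))     ≡⟨ cong (9 *_) (value-∷ (# 1) (replicate n (# 1))) ⟨
  9 * value (replicate (suc n) (# 1))              ∎
  where
  open ≡-Reasoning
  distrib : ∀ p v → 9 * p + 9 * v ≡ 9 * (1 * p + v)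
  distrib = solve-∀

repunit≡value-ones : ∀ n → repunit n ≡ value (replicate n (# 1))
repunit≡value-ones n = begin
  (10 ^ n ∸ 1) / 9                            ≡⟨ cong (λ p → (p ∸ 1) / 9) (1+value-nines n) ⟨
  value (replicate n (# 9)) / 9               ≡⟨ cong (_/ 9) (value-nines≡9*value-ones n) ⟩
  9 * value (replicate n (# 1)) / 9           ≡⟨ cong (_/ 9) (*-comm 9 (value (replicate n (# 1)))) ⟩
  value (replicate n (# 1)) * 9 / 9           ≡⟨ m*n/n≡m _ 9 ⟩
  value (replicate n (# 1))                   ∎
  where open ≡-Reasoning

repunit-suc≢0 : ∀ n → repunit (suc n) ≢ 0
repunit-suc≢0 n eq = 10≢0 (m^n≡0⇒m≡0 10 n 10^n≡0)
  where
  10≢0 : 10 ≢ 0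
  10≢0 ()
  value≡0 : 1 * 10 ^ n + value (replicate n (# 1)) ≡ 0
  value≡0 = trans (sym (value-∷ (# 1) (replicate n (# 1)))) (trans (sym (repunit≡value-ones (suc n))) eq)
  10^n≡0 : 10 ^ n ≡ 0
  10^n≡0 = trans (sym (*-identityˡ (10 ^ n))) (m+n≡0⇒m≡0 _ value≡0)

powerOfTen : ∀ n → Digits (suc n)
powerOfTen n = # 1 ∷ replicate n (# 0)

reverse-powerOfTen : ∀ n → reverse (powerOfTen n) ≡ replicate n (# 0) ∷ʳ # 1
reverse-powerOfTen n = trans (reverse-∷ (# 1) (replicate n (# 0))) (cong (_∷ʳ # 1) (reverse-replicate n (# 0)))

value-powerOfTen : ∀ n → value (powerOfTen n) ≡ 10 ^ n
value-powerOfTen n = begin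
  value (powerOfTen n)                        ≡⟨ value-∷ (# 1) (replicate n (# 0)) ⟩
  1 * 10 ^ n + value (replicate n (# 0))      ≡⟨ cong₂ _+_ (*-identityˡ (10 ^ n)) (value-zeros n) ⟩
  10 ^ n + 0                                  ≡⟨ +-identityʳ (10 ^ n) ⟩
  10 ^ n                                      ∎
  where open ≡-Reasoning

value-reverse-powerOfTen : ∀ n → value (reverse (powerOfTen n)) ≡ 1
value-reverse-powerOfTen n = begin
  value (reverse (powerOfTen n))              ≡⟨ cong value (reverse-powerOfTen n) ⟩
  value (replicate n (# 0) ∷ʳ # 1)            ≡⟨ value-∷ʳ (replicate n (# 0)) (# 1) ⟩
  10 * value (replicate n (# 0)) + 1          ≡⟨ cong (λ v → 10 * v + 1) (value-zeros n) ⟩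
  1                                           ∎
  where open ≡-Reasoning

powerOfTen-not-palindrome : ∀ n → reverse (powerOfTen (suc n)) ≢ powerOfTen (suc n)
powerOfTen-not-palindrome n eq with trans (sym (reverse-powerOfTen (suc n))) eq
... | ()

difference-powerOfTen : ∀ n → ∣ value (powerOfTen n) - value (reverse (powerOfTen n)) ∣ ≡ value (# 0 ∷ replicate n (# 9))
difference-powerOfTen n = begin
  ∣ value (powerOfTen n) - value (reverse (powerOfTen n)) ∣  ≡⟨ cong₂ ∣_-_∣ (value-powerOfTen n) (value-reverse-powerOfTen n) ⟩
  ∣ 10 ^ n - 1 ∣                                             ≡⟨ cong (∣_- 1 ∣) (1+value-nines n) ⟨
  ∣ 1 + value (replicate n (# 9)) - 1 ∣                      ≡⟨ m≤n⇒∣n-m∣≡n∸m (s≤s z≤n) ⟩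
  value (replicate n (# 9))                                  ≡⟨ value-∷ (# 0) (replicate n (# 9)) ⟨
  value (# 0 ∷ replicate n (# 9))                            ∎
  where open ≡-Reasoning

value-reverse-0∷ : ∀ {N} (xs : Digits N) → value (reverse (# 0 ∷ xs)) ≡ 10 * value (reverse xs)
value-reverse-0∷ xs = trans (cong value (reverse-∷ (# 0) xs)) (trans (value-∷ʳ (reverse xs) (# 0)) (+-identityʳ _))

ballOf-powerOfTen : ∀ n → ballOf (powerOfTen n) ≡ 99 * repunit n
ballOf-powerOfTen n = begin
  ballOf (powerOfTen n)                             ≡⟨ cong (λ y → y + revN (suc n) y) (difference-powerOfTen n) ⟩
  value zeroNines + revN (suc n) (value zeroNines)  ≡⟨ cong (value zeroNines +_) (revN-value zeroNines) ⟩
  value zeroNines + value (reverse zeroNines)       ≡⟨ cong (value zeroNines +_) (value-reverse-0∷ nines) ⟩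
  value nines + 10 * value (reverse nines)          ≡⟨ cong (λ v → value nines + 10 * value v) (reverse-replicate n (# 9)) ⟩
  value nines + 10 * value nines                    ≡⟨ cong (λ v → v + 10 * v) (value-nines≡9*value-ones n) ⟩
  9 * ones + 10 * (9 * ones)                        ≡⟨ eleven-nines ones ⟩
  99 * ones                                         ≡⟨ cong (99 *_) (repunit≡value-ones n) ⟨
  99 * repunit n                                    ∎
  where
  open ≡-Reasoning
  nines : Digits n
  nines = replicate n (# 9)
  zeroNines : Digits (suc n)
  zeroNines = # 0 ∷ nines
  ones : ℕ
  ones = value (replicate n (# 1))
  eleven-nines : ∀ r → 9 * r + 10 * (9 * r) ≡ 99 * r
  eleven-nines = solve-∀

corollary2 : (n : ℕ) → n > 0 → BallMagic (99 * repunit n)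
corollary2 (suc n) _ =
  suc (suc n) , s≤s (s≤s z≤n) , powerOfTen (suc n) , (λ ()) , powerOfTen-not-palindrome n ,
  ballOf-powerOfTen (suc n) , λ B≡0 → repunit-suc≢0 n (99*r≡0⇒r≡0 B≡0)
  where
  99*r≡0⇒r≡0 : ∀ {r} → 99 * r ≡ 0 → r ≡ 0
  99*r≡0⇒r≡0 eq with m*n≡0⇒m≡0∨n≡0 99 eq
  ... | inj₂ r≡0 = r≡0
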